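{- Let $\mathcal C$ be a polarized GoI situation. For any morphisms $f: X_2 \otimes U \to Y_2 \otimes U$, $g: X_1 \otimes 1 \to Y_1 \otimes 1$, $a: X_1 \to X_2$, $b: Y_1 \to Y_2$ and any morphism $p: 1 \to U$ (a point of $U$), if $$f \circ (a \otimes p) = (b \otimes p) \circ g ,$$ then $$\mathrm{Tr}^{U}_{X_2,Y_2}(f) \circ a = b \circ \mathrm{Tr}^{1}_{X_1,Y_1}(g).$$
   Context: A polarized GoI situation consists of the following data and axioms. (1) A traced symmetric monoidal category $(\mathcal C,\otimes,I,s)$ with trace operators $\mathrm{Tr}^Z_{X,Y}:\mathcal C(X\otimes Z,Y\otimes Z)\to \mathcal C(X,Y)$ (satisfying the usual trace axioms); canonical associativity/unit isomorphisms of $\otimes$ are suppressed, and $X^m$ denotes the $m$-fold tensor power of $X$. (2) An object $U$ with morphisms $k:U\to U\otimes U$, $j:U\otimes U\to U$ such that $k\circ j=\mathrm{Id}_{U\otimes U}$. (3) An object $1$ (in general $1\neq I$) with morphisms $!:1\otimes 1\to 1$, $r:1\to 1\otimes 1$ such that $!\circ r=\mathrm{Id}_1$. (4) Any morphism $1\to U$ is called a point of $U$; there is a distinguished point $\alpha:1\to U$. (5) (Uniformity of trace) For every point $p:1\to U$ and all $f:X\otimes U\to Y\otimes U$, $g:X\otimes 1\to Y\otimes 1$ with $f\circ(X\otimes p)=(Y\otimes p)\circ g$, one has $\mathrm{Tr}^U_{X,Y}(f)=\mathrm{Tr}^1_{X,Y}(g)$. (6) (Lifting) Morphisms $!_\alpha:U\otimes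 1\to U$, $r_\alpha:U\to U\otimes 1$ with $!_\alpha\circ r_\alpha=\mathrm{Id}_U$, $!_\alpha\circ(\alpha\otimes 1)=\alpha\circ !$ and $r_\alpha\circ\alpha=(\alpha\otimes 1)\circ r$. (7) A morphism $\alpha^*:U\to 1$ with $\alpha^*\circ\alpha=\mathrm{Id}_1$. (8) (Zero morphisms) A family of morphisms $0_{X,Y}:X\to Y$ for all objects $X,Y$ with $g\circ 0_{X,Y}\circ f=0_{W,Z}$ for all $f:W\to X$, $g:Y\to Z$; write $0:=0_{1,1}$. (9) For every $f:V\otimes U\to W\otimes U$, $(\mathrm{Id}_W\otimes !_\alpha)\circ(f\otimes 0)\circ(\mathrm{Id}_V\otimes r_\alpha)=f$, and for every $f:V\otimes 1\to W\otimes 1$, $(\mathrm{Id}_W\otimes !)\circ(f\otimes 0)\circ(\mathrm{Id}_V\otimes r)=f$. -}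

module Defs where

open import Level using (Level; _⊔_) renaming (suc to lsuc)
open import Relation.Binary using (IsEquivalence)

record Category (o m e : Level) : Set (lsuc (o ⊔ m ⊔ e)) where
  infix  4 _≈_
  infixr 9 _∘_
  field
    Obj : Set o
    Hom : Obj → Obj → Set m
    _≈_ : ∀ {A B} → Hom A B → Hom A B → Set e
    id  : ∀ {A} → Hom A A
    _∘_ : ∀ {A B C} → Hom B C → Hom A B → Hom A C
    ≈-equiv   : ∀ {A B} → IsEquivalence (_≈_ {A} {B})
    ∘-resp-≈  : ∀ {A B C} {f f′ : Hom B C} {g g′ : Hom A B} →
                f ≈ f′ → g ≈ g′ → f ∘ g ≈ f′ ∘ g′
    identityˡ : ∀ {A B} {f : Hom A B} → id ∘ f ≈ f
    identityʳ : ∀ {A B} {f : Hom A B} → f ∘ id ≈ f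
    assoc     : ∀ {A B C D} {f : Hom A B} {g : Hom B C} {h : Hom C D} →
                (h ∘ g) ∘ f ≈ h ∘ (g ∘ f)

record SymmetricMonoidalCategory (o m e : Level) : Set (lsuc (o ⊔ m ⊔ e)) where
  field
    category : Category o m e
  open Category category public
  infixr 10 _⊗₀_ _⊗₁_
  field
    _⊗₀_ : Obj → Obj → Obj
    I    : Obj
    _⊗₁_ : ∀ {A B C D} → Hom A B → Hom C D → Hom (A ⊗₀ C) (B ⊗₀ D)
    ⊗-resp-≈ : ∀ {A B C D} {f f′ : Hom A B} {g g′ : Hom C D} →
               f ≈ f′ → g ≈ g′ → f ⊗₁ g ≈ f′ ⊗₁ g′
    ⊗-id : ∀ {A B} → id {A} ⊗₁ id {B} ≈ id
    ⊗-∘  : ∀ {A B C D E F} {f : Hom B C} {g : Hom A B} {h : Hom E F} {k : Hom D E} →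
           (f ∘ g) ⊗₁ (h ∘ k) ≈ (f ⊗₁ h) ∘ (g ⊗₁ k)
    λ⇒ : ∀ {A} → Hom (I ⊗₀ A) A
    λ⇐ : ∀ {A} → Hom A (I ⊗₀ A)
    ρ⇒ : ∀ {A} → Hom (A ⊗₀ I) A
    ρ⇐ : ∀ {A} → Hom A (A ⊗₀ I)
    a⇒ : ∀ {A B C} → Hom ((A ⊗₀ B) ⊗₀ C) (A ⊗₀ (B ⊗₀ C))
    a⇐ : ∀ {A B C} → Hom (A ⊗₀ (B ⊗₀ C)) ((A ⊗₀ B) ⊗₀ C)
    σ  : ∀ {A B} → Hom (A ⊗₀ B) (B ⊗₀ A)
    λ-isoˡ : ∀ {A} → λ⇐ {A} ∘ λ⇒ ≈ id
    λ-isoʳ : ∀ {A} → λ⇒ {A} ∘ λ⇐ ≈ id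
    ρ-isoˡ : ∀ {A} → ρ⇐ {A} ∘ ρ⇒ ≈ id
    ρ-isoʳ : ∀ {A} → ρ⇒ {A} ∘ ρ⇐ ≈ id
    a-isoˡ : ∀ {A B C} → a⇐ {A} {B} {C} ∘ a⇒ ≈ id
    a-isoʳ : ∀ {A B C} → a⇒ {A} {B} {C} ∘ a⇐ ≈ id
    λ-natural : ∀ {A B} {f : Hom A B} → λ⇒ ∘ (id {I} ⊗₁ f) ≈ f ∘ λ⇒
    ρ-natural : ∀ {A B} {f : Hom A B} → ρ⇒ ∘ (f ⊗₁ id {I}) ≈ f ∘ ρ⇒
    a-natural : ∀ {A B C D E F} {f : Hom A D} {g : Hom B E} {h : Hom C F} →
                a⇒ ∘ ((f ⊗₁ g) ⊗₁ h) ≈ (f ⊗₁ (g ⊗₁ h)) ∘ a⇒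
    σ-natural : ∀ {A B C D} {f : Hom A C} {g : Hom B D} →
                σ ∘ (f ⊗₁ g) ≈ (g ⊗₁ f) ∘ σ
    triangle : ∀ {A B} → (id {A} ⊗₁ λ⇒ {B}) ∘ a⇒ ≈ ρ⇒ ⊗₁ id {B}
    pentagon : ∀ {A B C D} →
               (id {A} ⊗₁ a⇒ {B} {C} {D}) ∘ a⇒ ∘ (a⇒ ⊗₁ id {D}) ≈ a⇒ ∘ a⇒
    hexagon  : ∀ {A B C} →
               a⇒ {B} {C} {A} ∘ σ ∘ a⇒ {A} {B} {C} ≈ (id {B} ⊗₁ σ) ∘ a⇒ ∘ (σ ⊗₁ id {C})
    σ-involutive : ∀ {A B} → σ {B} {A} ∘ σ {A} {B} ≈ id

record TracedSMC (o m e : Level) : Set (lsuc (o ⊔ m ⊔ e)) where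
  field
    smc : SymmetricMonoidalCategory o m e
  open SymmetricMonoidalCategory smc public
  field
    Tr : ∀ {X Y Z} → Hom (X ⊗₀ Z) (Y ⊗₀ Z) → Hom X Y
    Tr-resp-≈ : ∀ {X Y Z} {f f′ : Hom (X ⊗₀ Z) (Y ⊗₀ Z)} → f ≈ f′ → Tr f ≈ Tr f′
    tightening : ∀ {X X′ Y Y′ Z} {f : Hom (X ⊗₀ Z) (Y ⊗₀ Z)} {g : Hom Y Y′} {h : Hom X′ X} →
                 Tr ((g ⊗₁ id {Z}) ∘ f ∘ (h ⊗₁ id {Z})) ≈ g ∘ Tr f ∘ h
    sliding : ∀ {X Y Z Z′} {f : Hom (X ⊗₀ Z) (Y ⊗₀ Z′)} {g : Hom Z′ Z} →
              Tr ((id {Y} ⊗₁ g) ∘ f) ≈ Tr (f ∘ (id {X} ⊗₁ g))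
    vanishingI : ∀ {X Y} {f : Hom (X ⊗₀ I) (Y ⊗₀ I)} → Tr f ≈ ρ⇒ ∘ f ∘ ρ⇐
    vanishingII : ∀ {X Y Z W} {f : Hom (X ⊗₀ (Z ⊗₀ W)) (Y ⊗₀ (Z ⊗₀ W))} →
                  Tr f ≈ Tr (Tr (a⇐ ∘ f ∘ a⇒))
    superposing : ∀ {V W X Y Z} {g : Hom W V} {f : Hom (X ⊗₀ Z) (Y ⊗₀ Z)} →
                  Tr (a⇐ ∘ (g ⊗₁ f) ∘ a⇒) ≈ g ⊗₁ Tr f
    yanking : ∀ {X} → Tr (σ {X} {X}) ≈ id

record PolarizedGoI (o m e : Level) : Set (lsuc (o ⊔ m ⊔ e)) where
  field
    traced : TracedSMC o m e
  open TracedSMC traced public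
  field
    U : Obj
    k : Hom U (U ⊗₀ U)
    j : Hom (U ⊗₀ U) U
    k∘j : k ∘ j ≈ id
    One : Obj
    bang : Hom (One ⊗₀ One) One
    r    : Hom One (One ⊗₀ One)
    bang∘r : bang ∘ r ≈ id
    pt : Hom One U
    uniformity : ∀ {X Y} (p : Hom One U)
                 (f : Hom (X ⊗₀ U) (Y ⊗₀ U)) (g : Hom (X ⊗₀ One) (Y ⊗₀ One)) →
                 f ∘ (id {X} ⊗₁ p) ≈ (id {Y} ⊗₁ p) ∘ g → Tr f ≈ Tr g
    bangα : Hom (U ⊗₀ One) U
    rα    : Hom U (U ⊗₀ One)
    bangα∘rα : bangα ∘ rα ≈ id
    bangα-pt : bangα ∘ (pt ⊗₁ id {One}) ≈ pt ∘ bang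
    rα-pt    : rα ∘ pt ≈ (pt ⊗₁ id {One}) ∘ r
    pt* : Hom U One
    pt*∘pt : pt* ∘ pt ≈ id
    zero : ∀ {X Y} → Hom X Y
    zero-absorb : ∀ {W X Y Z} (f : Hom W X) (g : Hom Y Z) → g ∘ zero {X} {Y} ∘ f ≈ zero
    zero-liftα : ∀ {V W} (f : Hom (V ⊗₀ U) (W ⊗₀ U)) →
                 (id {W} ⊗₁ bangα) ∘ a⇒ ∘ (f ⊗₁ zero {One} {One}) ∘ a⇐ ∘ (id {V} ⊗₁ rα) ≈ f
    zero-lift1 : ∀ {V W} (f : Hom (V ⊗₀ One) (W ⊗₀ One)) →
                 (id {W} ⊗₁ bang) ∘ a⇒ ∘ (f ⊗₁ zero {One} {One}) ∘ a⇐ ∘ (id {V} ⊗₁ r) ≈ f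

-- Both traces can be computed on the same side of the point p: tightening moves a and b
-- inside the traces, after which f ∘ (a ⊗ id) and (b ⊗ id) ∘ g are related by id ⊗ p,
-- and uniformity of the trace identifies them.
module Submission where

open import Defs
open import Level using (Level)
open import Relation.Binary.Bundles using (Setoid)
import Relation.Binary.Reasoning.Setoid as SetoidReasoning

module CategoryReasoning {o m e : Level} (𝒞 : Category o m e) where
  open Category 𝒞

  hom-setoid : Obj → Obj → Setoid m e
  hom-setoid A B = record { isEquivalence = ≈-equiv {A} {B} }

  module _ {A B : Obj} where
    open Setoid (hom-setoid A B) public using () renaming (refl to ≈-refl; sym to ≈-sym)
    open SetoidReasoning (hom-setoid A B) public

module SMCProperties {o m e : Level} (𝒞 : SymmetricMonoidalCategory o m e) where
  open SymmetricMonoidalCategory 𝒞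
  open CategoryReasoning category

  ⊗-split-right : ∀ {A B C D} (f : Hom A B) (g : Hom C D) → f ⊗₁ g ≈ (f ⊗₁ id) ∘ (id ⊗₁ g)
  ⊗-split-right f g = begin
    f ⊗₁ g                  ≈⟨ ⊗-resp-≈ (≈-sym identityʳ) (≈-sym identityˡ) ⟩
    (f ∘ id) ⊗₁ (id ∘ g)    ≈⟨ ⊗-∘ ⟩
    (f ⊗₁ id) ∘ (id ⊗₁ g)   ∎

  ⊗-split-left : ∀ {A B C D} (f : Hom A B) (g : Hom C D) → f ⊗₁ g ≈ (id ⊗₁ g) ∘ (f ⊗₁ id)
  ⊗-split-left f g = begin
    f ⊗₁ g                  ≈⟨ ⊗-resp-≈ (≈-sym identityˡ) (≈-sym identityʳ) ⟩
    (id ∘ f) ⊗₁ (g ∘ id)    ≈⟨ ⊗-∘ ⟩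
    (id ⊗₁ g) ∘ (f ⊗₁ id)   ∎

module TraceProperties {o m e : Level} (𝒯 : TracedSMC o m e) where
  open TracedSMC 𝒯
  open CategoryReasoning category

  Tr-∘ʳ : ∀ {X X′ Y Z} (f : Hom (X ⊗₀ Z) (Y ⊗₀ Z)) (h : Hom X′ X) →
          Tr f ∘ h ≈ Tr (f ∘ (h ⊗₁ id))
  Tr-∘ʳ f h = begin
    Tr f ∘ h                          ≈⟨ ≈-sym identityˡ ⟩
    id ∘ Tr f ∘ h                     ≈⟨ ≈-sym tightening ⟩
    Tr ((id ⊗₁ id) ∘ f ∘ (h ⊗₁ id))   ≈⟨ Tr-resp-≈ (∘-resp-≈ ⊗-id ≈-refl) ⟩
    Tr (id ∘ f ∘ (h ⊗₁ id))           ≈⟨ Tr-resp-≈ identityˡ ⟩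
    Tr (f ∘ (h ⊗₁ id))                ∎

  Tr-∘ˡ : ∀ {X Y Y′ Z} (f : Hom (X ⊗₀ Z) (Y ⊗₀ Z)) (g : Hom Y Y′) →
          g ∘ Tr f ≈ Tr ((g ⊗₁ id) ∘ f)
  Tr-∘ˡ f g = begin
    g ∘ Tr f                          ≈⟨ ∘-resp-≈ ≈-refl (≈-sym identityʳ) ⟩
    g ∘ Tr f ∘ id                     ≈⟨ ≈-sym tightening ⟩
    Tr ((g ⊗₁ id) ∘ f ∘ (id ⊗₁ id))   ≈⟨ Tr-resp-≈ (∘-resp-≈ ≈-refl (∘-resp-≈ ≈-refl ⊗-id)) ⟩
    Tr ((g ⊗₁ id) ∘ f ∘ id)           ≈⟨ Tr-resp-≈ (∘-resp-≈ ≈-refl identityʳ) ⟩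
    Tr ((g ⊗₁ id) ∘ f)                ∎

mainTheorem1 : ∀ {o m e : Level} (G : PolarizedGoI o m e) →
    let open PolarizedGoI G in
    ∀ {X₁ X₂ Y₁ Y₂ : Obj}
    (f : Hom (X₂ ⊗₀ U) (Y₂ ⊗₀ U)) (g : Hom (X₁ ⊗₀ One) (Y₁ ⊗₀ One))
    (a : Hom X₁ X₂) (b : Hom Y₁ Y₂) (p : Hom One U) →
    f ∘ (a ⊗₁ p) ≈ (b ⊗₁ p) ∘ g →
    Tr f ∘ a ≈ b ∘ Tr g
mainTheorem1 G f g a b p f∘a⊗p≈b⊗p∘g = begin
  Tr f ∘ a                ≈⟨ Tr-∘ʳ f a ⟩
  Tr (f ∘ (a ⊗₁ id))      ≈⟨ uniformity p _ _ intertwined ⟩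
  Tr ((b ⊗₁ id) ∘ g)      ≈⟨ ≈-sym (Tr-∘ˡ g b) ⟩
  b ∘ Tr g                ∎
  where
  open PolarizedGoI G
  open CategoryReasoning category
  open SMCProperties smc
  open TraceProperties traced

  intertwined : (f ∘ (a ⊗₁ id)) ∘ (id ⊗₁ p) ≈ (id ⊗₁ p) ∘ ((b ⊗₁ id) ∘ g)
  intertwined = begin
    (f ∘ (a ⊗₁ id)) ∘ (id ⊗₁ p)   ≈⟨ assoc ⟩
    f ∘ (a ⊗₁ id) ∘ (id ⊗₁ p)     ≈⟨ ∘-resp-≈ ≈-refl (≈-sym (⊗-split-right a p)) ⟩
    f ∘ (a ⊗₁ p)                  ≈⟨ f∘a⊗p≈b⊗p∘g ⟩
    (b ⊗₁ p) ∘ g                  ≈⟨ ∘-resp-≈ (⊗-split-left b p) ≈-refl ⟩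
    ((id ⊗₁ p) ∘ (b ⊗₁ id)) ∘ g   ≈⟨ assoc ⟩
    (id ⊗₁ p) ∘ (b ⊗₁ id) ∘ g     ∎
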